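{- Let $n \ge 2$ and let $a,b$ be integers with $1 \le a < b < n$. Consider the columns of the generalized cyclic table $\mathscr{C}(n,a,b)$. The following are equivalent: (i) for every column $A$ there exists a column $B \neq A$ with $|A \cap B| = 3$; (ii) $3 \mid n$, $a = \frac{n}{3}$ and $b = \frac{2n}{3}$.
   Context: The generalized cyclic table $\mathscr{C}(n,a,b)$, for $1 \le a < b < n$, has points $1,\dots,n$ (taken mod $n$). It has $n$ columns, the $j$-th being the ordered triple $[j,\ j+a,\ j+b]$ for $j=1,\dots,n$, with entries reduced mod $n$. Two columns $A,B$ are equal ($A=B$) if $A[i]=B[i]$ for $i=1,2,3$, where $A[i]$ is the $i$-th entry. $|A\cap B|$ denotes the number of points common to the underlying sets of entries. -}

module Defs where

open import Data.Nat using (ℕ; NonZero; _+_)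
open import Data.Nat.DivMod using (_%_)
open import Data.Fin using (Fin; toℕ)
open import Data.Fin.Subset using (Subset; ⁅_⁆; _∪_; _∩_; ∣_∣)
open import Data.Fin.Properties using ()
open import Data.Product using (_×_; _,_)
import Data.Fin as F

-- Points of the table: residues mod n, represented as Fin n
-- (point k ∈ {1,…,n} corresponds to k mod n).

Column : ℕ → Set
Column n = Fin n × Fin n × Fin n

modn : (n : ℕ) → .{{_ : NonZero n}} → ℕ → Fin n
modn n m = F.fromℕ< (Data.Nat.DivMod.m%n<n m n)
  where import Data.Nat.DivMod

column : (n a b : ℕ) → .{{_ : NonZero n}} → Fin n → Column n
column n a b j = modn n (toℕ j) , modn n (toℕ j + a) , modn n (toℕ j + b)

entries : {n : ℕ} → Column n → Subset n
entries (x , y , z) = ⁅ x ⁆ ∪ (⁅ y ⁆ ∪ ⁅ z ⁆)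

common : {n : ℕ} → Column n → Column n → ℕ
common A B = ∣ entries A ∩ entries B ∣

-- In ℤ/n write S = {0, a, b} for the point set of the column at 0. A column sharing all three
-- points with it starts at some k ∈ S with k ≠ 0, and its points k, k + a, k + b all lie in S.
-- Both for k = a and for k = b this forces a + b ≡ 0, and then 2a ∈ S resp. 2b ∈ S forces
-- b = 2a, so n = a + b = 3a. Conversely, if b = 2a and a + b = n, the column at j + a is the
-- column at j rotated, so the two share their three distinct points.
module Submission where

open import Defs
open import Data.Nat using (ℕ; NonZero; _≤_; _<_; _*_)
open import Data.Nat.Divisibility using (_∣_)
open import Data.Fin using (Fin)
open import Data.Product using (Σ; _×_)
open import Relation.Binary.PropositionalEquality using (_≡_; _≢_)
open import Function.Bundles using (_⇔_)

open import Data.Bool using (true; false)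
open import Data.Fin using (toℕ) renaming (zero to fzero; suc to fsuc)
open import Data.Fin.Properties using (toℕ-fromℕ<; toℕ-injective; toℕ<n)
open import Data.Fin.Subset using (Subset; ⁅_⁆; _∪_; _∩_; ∣_∣; _∈_; _∉_; _⊆_)
open import Data.Fin.Subset.Properties
  using (∣⁅x⁆∣≡1; x∈⁅x⁆; x∈⁅y⁆⇒x≡y; x∈p∪q⁻; x∈p∪q⁺; x∈p∩q⁻; p∩q⊆q; p⊂q⇒∣p∣<∣q∣; _∈?_;
         ∪-assoc; ∪-comm; ∪-identityˡ; ∩-idem)
open import Data.Nat using (suc; s≤s; >-nonZero⁻¹; _+_; _∸_; _<?_; _>_)
open import Data.Nat.Divisibility using (divides)
open import Data.Nat.DivMod using (_%_; m<n⇒m%n≡m; m%n%n≡m%n; %-distribˡ-+; [m+n]%n≡m%n; m≤n⇒[n∸m]%m≡n%m)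
open import Data.Nat.Properties
open import Data.Nat.Tactic.RingSolver using (solve-∀)
open import Data.Product using (_,_; proj₁)
open import Data.Sum using (_⊎_; inj₁; inj₂)
import Data.Sum as Sum
open import Data.Vec using (_∷_; here; there)
open import Function using (_∘_)
open import Function.Bundles using (mk⇔; module Equivalence)
open import Relation.Binary.PropositionalEquality using (refl; sym; trans; cong; cong₂; subst; subst₂; module ≡-Reasoning)
open import Relation.Nullary using (yes; no; contradiction)

∣⁅x⁆∪p∣≡1+∣p∣ : ∀ {n} (x : Fin n) (p : Subset n) → x ∉ p → ∣ ⁅ x ⁆ ∪ p ∣ ≡ suc ∣ p ∣
∣⁅x⁆∪p∣≡1+∣p∣ fzero    (true ∷ p)  x∉p = contradiction here x∉p
∣⁅x⁆∪p∣≡1+∣p∣ fzero    (false ∷ p) x∉p = cong (suc ∘ ∣_∣) (∪-identityˡ p)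
∣⁅x⁆∪p∣≡1+∣p∣ (fsuc x) (true ∷ p)  x∉p = cong suc (∣⁅x⁆∪p∣≡1+∣p∣ x p (x∉p ∘ there))
∣⁅x⁆∪p∣≡1+∣p∣ (fsuc x) (false ∷ p) x∉p = ∣⁅x⁆∪p∣≡1+∣p∣ x p (x∉p ∘ there)

∣⁅x⁆∪p∣≤1+∣p∣ : ∀ {n} (x : Fin n) (p : Subset n) → ∣ ⁅ x ⁆ ∪ p ∣ ≤ suc ∣ p ∣
∣⁅x⁆∪p∣≤1+∣p∣ fzero    (true ∷ p)  rewrite ∪-identityˡ p = n≤1+n _
∣⁅x⁆∪p∣≤1+∣p∣ fzero    (false ∷ p) rewrite ∪-identityˡ p = ≤-refl
∣⁅x⁆∪p∣≤1+∣p∣ (fsuc x) (true ∷ p)  = s≤s (∣⁅x⁆∪p∣≤1+∣p∣ x p)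
∣⁅x⁆∪p∣≤1+∣p∣ (fsuc x) (false ∷ p) = ∣⁅x⁆∪p∣≤1+∣p∣ x p

module _ {n : ℕ} where

  ∈-entries⁻ : ∀ {y x u v : Fin n} → y ∈ entries (x , u , v) → y ≡ x ⊎ y ≡ u ⊎ y ≡ v
  ∈-entries⁻ {x = x} {u} {v} y∈ with x∈p∪q⁻ ⁅ x ⁆ (⁅ u ⁆ ∪ ⁅ v ⁆) y∈
  ... | inj₁ y∈x = inj₁ (x∈⁅y⁆⇒x≡y x y∈x)
  ... | inj₂ y∈uv with x∈p∪q⁻ ⁅ u ⁆ ⁅ v ⁆ y∈uv
  ...   | inj₁ y∈u = inj₂ (inj₁ (x∈⁅y⁆⇒x≡y u y∈u))
  ...   | inj₂ y∈v = inj₂ (inj₂ (x∈⁅y⁆⇒x≡y v y∈v))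

  ∈-entries⁺ : ∀ {y x u v : Fin n} → y ≡ x ⊎ y ≡ u ⊎ y ≡ v → y ∈ entries (x , u , v)
  ∈-entries⁺ (inj₁ refl)        = x∈p∪q⁺ (inj₁ (x∈⁅x⁆ _))
  ∈-entries⁺ (inj₂ (inj₁ refl)) = x∈p∪q⁺ (inj₂ (x∈p∪q⁺ (inj₁ (x∈⁅x⁆ _))))
  ∈-entries⁺ (inj₂ (inj₂ refl)) = x∈p∪q⁺ (inj₂ (x∈p∪q⁺ (inj₂ (x∈⁅x⁆ _))))

  ∣entries∣≤3 : (A : Column n) → ∣ entries A ∣ ≤ 3
  ∣entries∣≤3 (x , u , v) = begin
    ∣ ⁅ x ⁆ ∪ (⁅ u ⁆ ∪ ⁅ v ⁆) ∣ ≤⟨ ∣⁅x⁆∪p∣≤1+∣p∣ x (⁅ u ⁆ ∪ ⁅ v ⁆) ⟩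
    suc ∣ ⁅ u ⁆ ∪ ⁅ v ⁆ ∣       ≤⟨ s≤s (∣⁅x⁆∪p∣≤1+∣p∣ u ⁅ v ⁆) ⟩
    suc (suc ∣ ⁅ v ⁆ ∣)         ≡⟨ cong (suc ∘ suc) (∣⁅x⁆∣≡1 v) ⟩
    3                           ∎
    where open ≤-Reasoning

  ∣entries∣≡3 : ∀ {x u v : Fin n} → x ≢ u → x ≢ v → u ≢ v → ∣ entries (x , u , v) ∣ ≡ 3
  ∣entries∣≡3 {x} {u} {v} x≢u x≢v u≢v = begin
    ∣ ⁅ x ⁆ ∪ (⁅ u ⁆ ∪ ⁅ v ⁆) ∣ ≡⟨ ∣⁅x⁆∪p∣≡1+∣p∣ x _ x∉uv ⟩
    suc ∣ ⁅ u ⁆ ∪ ⁅ v ⁆ ∣       ≡⟨ cong suc (∣⁅x⁆∪p∣≡1+∣p∣ u _ (u≢v ∘ x∈⁅y⁆⇒x≡y v)) ⟩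
    suc (suc ∣ ⁅ v ⁆ ∣)         ≡⟨ cong (suc ∘ suc) (∣⁅x⁆∣≡1 v) ⟩
    3                           ∎
    where
    open ≡-Reasoning
    x∉uv : x ∉ ⁅ u ⁆ ∪ ⁅ v ⁆
    x∉uv x∈uv with x∈p∪q⁻ ⁅ u ⁆ ⁅ v ⁆ x∈uv
    ... | inj₁ x∈u = x≢u (x∈⁅y⁆⇒x≡y u x∈u)
    ... | inj₂ x∈v = x≢v (x∈⁅y⁆⇒x≡y v x∈v)

  -- A point of B outside A would make A ∩ B a proper subset of B, which has at most 3 points.
  common≡3⇒entries⊆ : (A B : Column n) → common A B ≡ 3 → entries B ⊆ entries A
  common≡3⇒entries⊆ A B A∩B≡3 {y} y∈B with y ∈? entries A
  ... | yes y∈A = y∈A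
  ... | no  y∉A = contradiction (∣entries∣≤3 B) (<⇒≱ (begin-strict
    3                        ≡⟨ A∩B≡3 ⟨
    ∣ entries A ∩ entries B ∣ <⟨ p⊂q⇒∣p∣<∣q∣ (p∩q⊆q _ _ , y , y∈B , y∉A ∘ proj₁ ∘ x∈p∩q⁻ _ _) ⟩
    ∣ entries B ∣            ∎))
    where open ≤-Reasoning

  rotate : Column n → Column n
  rotate (x , u , v) = u , v , x

  common-rotate : (A : Column n) → common A (rotate A) ≡ ∣ entries A ∣
  common-rotate (x , u , v) = begin
    ∣ entries (x , u , v) ∩ (⁅ u ⁆ ∪ (⁅ v ⁆ ∪ ⁅ x ⁆)) ∣ ≡⟨ cong (λ S → ∣ entries (x , u , v) ∩ S ∣) rotated ⟩
    ∣ entries (x , u , v) ∩ entries (x , u , v) ∣     ≡⟨ cong ∣_∣ (∩-idem (entries (x , u , v))) ⟩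
    ∣ entries (x , u , v) ∣                           ∎
    where
    open ≡-Reasoning
    rotated : ⁅ u ⁆ ∪ (⁅ v ⁆ ∪ ⁅ x ⁆) ≡ entries (x , u , v)
    rotated = trans (sym (∪-assoc ⁅ u ⁆ ⁅ v ⁆ ⁅ x ⁆)) (∪-comm (⁅ u ⁆ ∪ ⁅ v ⁆) ⁅ x ⁆)

module _ {m n o : ℕ} .{{_ : NonZero o}} where

  m+n≡[m+n]%o+o : m < o → n < o → o ≤ m + n → m + n ≡ (m + n) % o + o
  m+n≡[m+n]%o+o m<o n<o o≤m+n = begin
    m + n                ≡⟨ m∸n+n≡m o≤m+n ⟨
    (m + n ∸ o) + o      ≡⟨ cong (_+ o) (m<n⇒m%n≡m (m<n+o⇒m∸n<o (m + n) o (+-mono-< m<o n<o))) ⟨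
    (m + n ∸ o) % o + o  ≡⟨ cong (_+ o) (m≤n⇒[n∸m]%m≡n%m o≤m+n) ⟩
    (m + n) % o + o      ∎
    where open ≡-Reasoning

  [m+n]%o≢m : m < o → n > 0 → n < o → (m + n) % o ≢ m
  [m+n]%o≢m m<o n>0 n<o r≡m with m + n <? o
  ... | yes m+n<o = <⇒≢ (m<m+n m n>0) (sym (trans (sym (m<n⇒m%n≡m m+n<o)) r≡m))
  ... | no  m+n≮o = <⇒≢ n<o (+-cancelˡ-≡ m n o (trans (m+n≡[m+n]%o+o m<o n<o (≮⇒≥ m+n≮o)) (cong (_+ o) r≡m)))

  [m%o+n]%o≡[m+n]%o : (m % o + n) % o ≡ (m + n) % o
  [m%o+n]%o≡[m+n]%o = begin
    (m % o + n) % o          ≡⟨ %-distribˡ-+ (m % o) n o ⟩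
    (m % o % o + n % o) % o  ≡⟨ cong (λ r → (r + n % o) % o) (m%n%n≡m%n m o) ⟩
    (m % o + n % o) % o      ≡⟨ %-distribˡ-+ m n o ⟨
    (m + n) % o              ∎
    where open ≡-Reasoning

3*[a+a]≡2*[3*a] : ∀ a → 3 * (a + a) ≡ 2 * (3 * a)
3*[a+a]≡2*[3*a] = solve-∀

thirds⇔a+b≡n×b≡a+a : ∀ {n a b} → (3 ∣ n × 3 * a ≡ n × 3 * b ≡ 2 * n) ⇔ (a + b ≡ n × b ≡ a + a)
thirds⇔a+b≡n×b≡a+a {n} {a} {b} = mk⇔ to from
  where
  open ≡-Reasoning

  to : 3 ∣ n × 3 * a ≡ n × 3 * b ≡ 2 * n → a + b ≡ n × b ≡ a + a
  to (_ , 3a≡n , 3b≡2n) = *-cancelˡ-≡ (a + b) n 3 (begin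
      3 * (a + b)     ≡⟨ *-distribˡ-+ 3 a b ⟩
      3 * a + 3 * b   ≡⟨ cong₂ _+_ 3a≡n 3b≡2n ⟩
      3 * n           ∎)
    , *-cancelˡ-≡ b (a + a) 3 (begin
      3 * b           ≡⟨ 3b≡2n ⟩
      2 * n           ≡⟨ cong (2 *_) 3a≡n ⟨
      2 * (3 * a)     ≡⟨ 3*[a+a]≡2*[3*a] a ⟨
      3 * (a + a)     ∎)

  from : a + b ≡ n × b ≡ a + a → 3 ∣ n × 3 * a ≡ n × 3 * b ≡ 2 * n
  from (a+b≡n , b≡a+a) = divides a (trans (sym 3a≡n) (*-comm 3 a)) , 3a≡n , (begin
      3 * b           ≡⟨ cong (3 *_) b≡a+a ⟩
      3 * (a + a)     ≡⟨ 3*[a+a]≡2*[3*a] a ⟩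
      2 * (3 * a)     ≡⟨ cong (2 *_) 3a≡n ⟩
      2 * n           ∎)
    where
    3a≡n : 3 * a ≡ n
    3a≡n = begin
      3 * a           ≡⟨ cong (λ x → a + (a + x)) (+-identityʳ a) ⟩
      a + (a + a)     ≡⟨ cong (a +_) b≡a+a ⟨
      a + b           ≡⟨ a+b≡n ⟩
      n               ∎

module _ {n : ℕ} .{{_ : NonZero n}} where

  infixl 6 _⊕_
  _⊕_ : Fin n → ℕ → Fin n
  j ⊕ d = modn n (toℕ j + d)

  origin : Fin n
  origin = modn n 0

  toℕ-modn : ∀ m → toℕ (modn n m) ≡ m % n
  toℕ-modn m = toℕ-fromℕ< _

  modn-toℕ : (j : Fin n) → modn n (toℕ j) ≡ j
  modn-toℕ j = toℕ-injective (trans (toℕ-modn (toℕ j)) (m<n⇒m%n≡m (toℕ<n j)))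

  toℕ-origin : toℕ origin ≡ 0
  toℕ-origin = trans (toℕ-modn 0) (m<n⇒m%n≡m (>-nonZero⁻¹ n))

  toℕ-origin⊕ : ∀ m → toℕ (origin ⊕ m) ≡ m % n
  toℕ-origin⊕ m = trans (toℕ-modn (toℕ origin + m)) (cong (λ r → (r + m) % n) toℕ-origin)

  toℕ-origin⊕m≡m : ∀ {m} → m < n → toℕ (origin ⊕ m) ≡ m
  toℕ-origin⊕m≡m {m} m<n = trans (toℕ-origin⊕ m) (m<n⇒m%n≡m m<n)

  ⊕-assoc : (j : Fin n) (c d : ℕ) → j ⊕ c ⊕ d ≡ j ⊕ (c + d)
  ⊕-assoc j c d = toℕ-injective (begin
    toℕ (j ⊕ c ⊕ d)          ≡⟨ toℕ-modn (toℕ (j ⊕ c) + d) ⟩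
    (toℕ (j ⊕ c) + d) % n    ≡⟨ cong (λ r → (r + d) % n) (toℕ-modn (toℕ j + c)) ⟩
    ((toℕ j + c) % n + d) % n ≡⟨ [m%o+n]%o≡[m+n]%o ⟩
    (toℕ j + c + d) % n      ≡⟨ cong (_% n) (+-assoc (toℕ j) c d) ⟩
    (toℕ j + (c + d)) % n    ≡⟨ toℕ-modn (toℕ j + (c + d)) ⟨
    toℕ (j ⊕ (c + d))        ∎)
    where open ≡-Reasoning

  j⊕n≡j : (j : Fin n) → j ⊕ n ≡ j
  j⊕n≡j j = toℕ-injective (begin
    toℕ (j ⊕ n)       ≡⟨ toℕ-modn (toℕ j + n) ⟩
    (toℕ j + n) % n   ≡⟨ [m+n]%n≡m%n (toℕ j) n ⟩
    toℕ j % n         ≡⟨ m<n⇒m%n≡m (toℕ<n j) ⟩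
    toℕ j             ∎)
    where open ≡-Reasoning

  j⊕d≢j : (j : Fin n) {d : ℕ} → d > 0 → d < n → j ⊕ d ≢ j
  j⊕d≢j j d>0 d<n j⊕d≡j = [m+n]%o≢m (toℕ<n j) d>0 d<n (trans (sym (toℕ-modn _)) (cong toℕ j⊕d≡j))

  column≡ : (a b : ℕ) (j : Fin n) → column n a b j ≡ (j , j ⊕ a , j ⊕ b)
  column≡ a b j = cong (_, j ⊕ a , j ⊕ b) (modn-toℕ j)

HasTwin : (n a b : ℕ) .{{_ : NonZero n}} → Fin n → Set
HasTwin n a b i =
  Σ (Fin n) λ k → (column n a b k ≢ column n a b i) × (common (column n a b i) (column n a b k) ≡ 3)

infix 4 _∈｛0,_,_｝
_∈｛0,_,_｝ : ℕ → ℕ → ℕ → Set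
x ∈｛0, a , b ｝ = x ≡ 0 ⊎ x ≡ a ⊎ x ≡ b

module _ {n a b : ℕ} .{{_ : NonZero n}} (a>0 : a > 0) (a<b : a < b) (b<n : b < n) where

  private
    a<n : a < n
    a<n = <-trans a<b b<n

    b>0 : b > 0
    b>0 = <-trans a>0 a<b

    column₀ : Column n
    column₀ = origin , origin ⊕ a , origin ⊕ b

  [a+b]%n∈⇒a+b≡n : (a + b) % n ∈｛0, a , b ｝ → a + b ≡ n
  [a+b]%n∈⇒a+b≡n (inj₁ r≡0) with a + b <? n
  ... | yes a+b<n = contradiction (trans (sym (m<n⇒m%n≡m a+b<n)) r≡0) (n>0⇒n≢0 (<-≤-trans a>0 (m≤m+n a b)))
  ... | no  a+b≮n = trans (m+n≡[m+n]%o+o a<n b<n (≮⇒≥ a+b≮n)) (cong (_+ n) r≡0)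
  [a+b]%n∈⇒a+b≡n (inj₂ (inj₁ r≡a)) = contradiction r≡a ([m+n]%o≢m a<n b>0 b<n)
  [a+b]%n∈⇒a+b≡n (inj₂ (inj₂ r≡b)) = contradiction (trans (cong (_% n) (+-comm b a)) r≡b) ([m+n]%o≢m b<n a>0 a<n)

  [a+a]%n∈⇒b≡a+a : a + b ≡ n → (a + a) % n ∈｛0, a , b ｝ → b ≡ a + a
  [a+a]%n∈⇒b≡a+a a+b≡n r∈ = a+a∈⇒b≡a+a (subst (_∈｛0, a , b ｝) (m<n⇒m%n≡m a+a<n) r∈)
    where
    a+a<n : a + a < n
    a+a<n = subst (a + a <_) a+b≡n (+-monoʳ-< a a<b)

    a+a∈⇒b≡a+a : a + a ∈｛0, a , b ｝ → b ≡ a + a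
    a+a∈⇒b≡a+a (inj₁ a+a≡0)        = contradiction (m+n≡0⇒m≡0 a a+a≡0) (n>0⇒n≢0 a>0)
    a+a∈⇒b≡a+a (inj₂ (inj₁ a+a≡a)) = contradiction (sym a+a≡a) (<⇒≢ (m<m+n a a>0))
    a+a∈⇒b≡a+a (inj₂ (inj₂ a+a≡b)) = sym a+a≡b

  [b+b]%n∈⇒b≡a+a : a + b ≡ n → (b + b) % n ∈｛0, a , b ｝ → b ≡ a + a
  [b+b]%n∈⇒b≡a+a a+b≡n = wrapped
    where
    open ≡-Reasoning

    -- b + b wraps around exactly once, since n = a + b ≤ b + b < 2n.
    b+b≡r+n : b + b ≡ (b + b) % n + n
    b+b≡r+n = m+n≡[m+n]%o+o b<n b<n (subst (_≤ b + b) a+b≡n (+-monoˡ-≤ b (<⇒≤ a<b)))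

    wrapped : (b + b) % n ∈｛0, a , b ｝ → b ≡ a + a
    wrapped (inj₁ r≡0) = contradiction (+-cancelʳ-≡ b b a (begin
      b + b           ≡⟨ b+b≡r+n ⟩
      (b + b) % n + n ≡⟨ cong (_+ n) r≡0 ⟩
      n               ≡⟨ a+b≡n ⟨
      a + b           ∎)) (<⇒≢ a<b ∘ sym)
    wrapped (inj₂ (inj₁ r≡a)) = +-cancelʳ-≡ b b (a + a) (begin
      b + b           ≡⟨ b+b≡r+n ⟩
      (b + b) % n + n ≡⟨ cong (_+ n) r≡a ⟩
      a + n           ≡⟨ cong (a +_) a+b≡n ⟨
      a + (a + b)     ≡⟨ +-assoc a a b ⟨
      a + a + b       ∎)
    wrapped (inj₂ (inj₂ r≡b)) = contradiction r≡b ([m+n]%o≢m b<n b>0 b<n)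

  origin⊕m∈column₀⇒m%n∈ : ∀ {m} → origin ⊕ m ∈ entries column₀ → m % n ∈｛0, a , b ｝
  origin⊕m∈column₀⇒m%n∈ {m} o⊕m∈ =
    Sum.map (λ e → trans (m%n≡toℕ e) toℕ-origin)
            (Sum.map (λ e → trans (m%n≡toℕ e) (toℕ-origin⊕m≡m a<n)) (λ e → trans (m%n≡toℕ e) (toℕ-origin⊕m≡m b<n)))
            (∈-entries⁻ o⊕m∈)
    where
    m%n≡toℕ : ∀ {y} → origin ⊕ m ≡ y → m % n ≡ toℕ y
    m%n≡toℕ e = trans (sym (toℕ-origin⊕ m)) (cong toℕ e)

  twin-of-origin⇒a+b≡n×b≡a+a : HasTwin n a b origin → a + b ≡ n × b ≡ a + a
  twin-of-origin⇒a+b≡n×b≡a+a (k , k≢origin , common≡3) = by-start (∈-entries⁻ (B⊆A (∈-entries⁺ (inj₁ refl))))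
    where
    B⊆A : entries (k , k ⊕ a , k ⊕ b) ⊆ entries column₀
    B⊆A = subst₂ (λ A B → entries B ⊆ entries A) (column≡ a b origin) (column≡ a b k)
            (common≡3⇒entries⊆ _ _ common≡3)

    along : ∀ {c d} → k ≡ origin ⊕ c → k ⊕ d ∈ entries (k , k ⊕ a , k ⊕ b) → (c + d) % n ∈｛0, a , b ｝
    along {c} {d} k≡o⊕c k⊕d∈B = origin⊕m∈column₀⇒m%n∈ (subst (_∈ entries column₀) k⊕d≡o⊕[c+d] (B⊆A k⊕d∈B))
      where k⊕d≡o⊕[c+d] = trans (cong (_⊕ d) k≡o⊕c) (⊕-assoc origin c d)

    k⊕a∈B : k ⊕ a ∈ entries (k , k ⊕ a , k ⊕ b)
    k⊕a∈B = ∈-entries⁺ (inj₂ (inj₁ refl))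

    k⊕b∈B : k ⊕ b ∈ entries (k , k ⊕ a , k ⊕ b)
    k⊕b∈B = ∈-entries⁺ (inj₂ (inj₂ refl))

    by-start : k ≡ origin ⊎ k ≡ origin ⊕ a ⊎ k ≡ origin ⊕ b → a + b ≡ n × b ≡ a + a
    by-start (inj₁ k≡o) = contradiction (cong (column n a b) k≡o) k≢origin
    by-start (inj₂ (inj₁ k≡o⊕a)) = a+b≡n , [a+a]%n∈⇒b≡a+a a+b≡n (along k≡o⊕a k⊕a∈B)
      where a+b≡n = [a+b]%n∈⇒a+b≡n (along k≡o⊕a k⊕b∈B)
    by-start (inj₂ (inj₂ k≡o⊕b)) = a+b≡n , [b+b]%n∈⇒b≡a+a a+b≡n (along k≡o⊕b k⊕b∈B)
      where a+b≡n = [a+b]%n∈⇒a+b≡n (subst (_∈｛0, a , b ｝) (cong (_% n) (+-comm b a)) (along k≡o⊕b k⊕a∈B))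

  column-⊕a≡rotate : a + b ≡ n → b ≡ a + a → (j : Fin n) → column n a b (j ⊕ a) ≡ rotate (column n a b j)
  column-⊕a≡rotate a+b≡n b≡a+a j = begin
    column n a b (j ⊕ a)            ≡⟨ column≡ a b (j ⊕ a) ⟩
    (j ⊕ a , j ⊕ a ⊕ a , j ⊕ a ⊕ b) ≡⟨ cong₂ (λ u v → j ⊕ a , u , v) j⊕a⊕a≡j⊕b j⊕a⊕b≡j ⟩
    rotate (j , j ⊕ a , j ⊕ b)      ≡⟨ cong rotate (column≡ a b j) ⟨
    rotate (column n a b j)         ∎
    where
    open ≡-Reasoning
    j⊕a⊕a≡j⊕b : j ⊕ a ⊕ a ≡ j ⊕ b
    j⊕a⊕a≡j⊕b = trans (⊕-assoc j a a) (cong (j ⊕_) (sym b≡a+a))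
    j⊕a⊕b≡j : j ⊕ a ⊕ b ≡ j
    j⊕a⊕b≡j = trans (⊕-assoc j a b) (trans (cong (j ⊕_) a+b≡n) (j⊕n≡j j))

  every-column-has-twin : a + b ≡ n → b ≡ a + a → (i : Fin n) → HasTwin n a b i
  every-column-has-twin a+b≡n b≡a+a i = i ⊕ a , distinct , common≡3
    where
    open ≡-Reasoning

    distinct : column n a b (i ⊕ a) ≢ column n a b i
    distinct e = j⊕d≢j i a>0 a<n (cong proj₁ (trans (sym (column≡ a b (i ⊕ a))) (trans e (column≡ a b i))))

    i⊕a≢i⊕b : i ⊕ a ≢ i ⊕ b
    i⊕a≢i⊕b e = j⊕d≢j (i ⊕ a) a>0 a<n (trans (⊕-assoc i a a) (trans (cong (i ⊕_) (sym b≡a+a)) (sym e)))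

    common≡3 : common (column n a b i) (column n a b (i ⊕ a)) ≡ 3
    common≡3 = begin
      common C (column n a b (i ⊕ a)) ≡⟨ cong (common C) (column-⊕a≡rotate a+b≡n b≡a+a i) ⟩
      common C (rotate C)             ≡⟨ common-rotate C ⟩
      ∣ entries C ∣                    ≡⟨ cong (∣_∣ ∘ entries) (column≡ a b i) ⟩
      ∣ entries (i , i ⊕ a , i ⊕ b) ∣  ≡⟨ ∣entries∣≡3 (j⊕d≢j i a>0 a<n ∘ sym) (j⊕d≢j i b>0 b<n ∘ sym) i⊕a≢i⊕b ⟩
      3                               ∎
      where C = column n a b i

mainTheorem7 : (n a b : ℕ) → .{{_ : NonZero n}} → 2 ≤ n → 1 ≤ a → a < b → b < n →
    ((∀ (i : Fin n) → Σ (Fin n) λ k →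
        (column n a b k ≢ column n a b i) × (common (column n a b i) (column n a b k) ≡ 3))
     ⇔ (3 ∣ n × 3 * a ≡ n × 3 * b ≡ 2 * n))
mainTheorem7 n a b _ a>0 a<b b<n = mk⇔
  (λ twins → Equivalence.from thirds⇔a+b≡n×b≡a+a (twin-of-origin⇒a+b≡n×b≡a+a a>0 a<b b<n (twins origin)))
  (λ thirds → let a+b≡n , b≡a+a = Equivalence.to thirds⇔a+b≡n×b≡a+a thirds in every-column-has-twin a>0 a<b b<n a+b≡n b≡a+a)
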